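{- Let $V$ be a finite nonempty set and $f$ a Boolean network on $V$. (1) $f$ is positive-circular if and only if $f$ is an even-self-dual and-net. (2) $f$ is negative-circular if and only if $f$ is an odd-self-dual and-net.
   Context: $\mathbb{B}=\{0,1\}$, $\oplus$ componentwise addition mod 2, $1$ the all-ones point; a point is even/odd according to the parity of its number of ones. A network on $V$ is $f:\mathbb{B}^V\to\mathbb{B}^V$; conjugate $\tilde f(x)=f(x)\oplus x$; self-dual if $f(x\oplus 1)=f(x)\oplus 1$ for all $x$; even (resp. odd) if $\tilde f(\mathbb{B}^V)$ is exactly the set of even (resp. odd) points; even-self-dual (resp. odd-self-dual) if even (resp. odd) and self-dual. With $x^{j\alpha}$ denoting $x$ with $j$-component set to $\alpha$, $f_{ij}(x)=f_i(x^{j1})-f_i(x^{j0})$. $G(f)$ is the signed digraph on $V$ with a positive arc $j\to i$ if $f_{ij}(x)=1$ for some $x$ and a negative arc $j\to i$ if $f_{ij}(x)=-1$ for some $x$; it is simple if it has at most one arc from any vertex to any vertex. $f$ is an and-net if $G(f)$ is simple and for every $i$ and $x$: $f_i(x)=1$ iff there is no positive arc $j\to i$ with $x_j=0$ and no negative arc $j\to i$ with $x_j=1$. $f$ is positive-circular (resp. negative-circular) if $G(f)$ is simple, its underlying unsigned digraph is a directed cycle through all of $V$ (a loop if $|V|=1$), and it has an even (resp. odd) number of negative arcs. -}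

module Defs where

open import Data.Bool using (Bool; true; false; _xor_; not)
open import Data.Nat using (ℕ; zero; suc; _+_; _%_)
open import Data.Fin using (Fin)
open import Data.Vec using (Vec; []; _∷_; lookup; _[_]≔_; replicate; zipWith; tabulate; foldr)
open import Data.Product using (Σ; ∃; _×_; _,_)
open import Data.Sum using (_⊎_)
open import Data.Empty using (⊥)
open import Relation.Nullary using (¬_)
open import Relation.Binary.PropositionalEquality using (_≡_)
open import Function using (_∘_)
open import Function.Bundles using (_⇔_)

-- Points of 𝔹^V with V = Fin n
Point : ℕ → Set
Point n = Vec Bool n

Network : ℕ → Set
Network n = Point n → Point n

_⊕_ : ∀ {n} → Point n → Point n → Point n
_⊕_ = zipWith _xor_

ones : ∀ {n} → Point n
ones = replicate _ true

weight : ∀ {n} → Point n → ℕ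
weight [] = 0
weight (true ∷ x) = suc (weight x)
weight (false ∷ x) = weight x

EvenNat : ℕ → Set
EvenNat k = k % 2 ≡ 0

EvenPoint OddPoint : ∀ {n} → Point n → Set
EvenPoint x = EvenNat (weight x)
OddPoint x = ¬ EvenPoint x

conj : ∀ {n} → Network n → Network n
conj f x = f x ⊕ x

SelfDual : ∀ {n} → Network n → Set
SelfDual f = ∀ x → f (x ⊕ ones) ≡ f x ⊕ ones

IsEvenNet IsOddNet : ∀ {n} → Network n → Set
IsEvenNet f = ∀ y → (∃ λ x → conj f x ≡ y) ⇔ EvenPoint y
IsOddNet  f = ∀ y → (∃ λ x → conj f x ≡ y) ⇔ OddPoint y

EvenSelfDual OddSelfDual : ∀ {n} → Network n → Set
EvenSelfDual f = IsEvenNet f × SelfDual f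
OddSelfDual  f = IsOddNet f × SelfDual f

-- signed interaction graph G(f):
-- positive arc j → i iff f_ij(x) = 1 for some x, i.e. f_i(x^{j0}) = 0 and f_i(x^{j1}) = 1
PosArc NegArc : ∀ {n} → Network n → Fin n → Fin n → Set
PosArc f j i = ∃ λ x → lookup (f (x [ j ]≔ false)) i ≡ false × lookup (f (x [ j ]≔ true)) i ≡ true
NegArc f j i = ∃ λ x → lookup (f (x [ j ]≔ false)) i ≡ true × lookup (f (x [ j ]≔ true)) i ≡ false

Arc : ∀ {n} → Network n → Fin n → Fin n → Set
Arc f j i = PosArc f j i ⊎ NegArc f j i

Simple : ∀ {n} → Network n → Set
Simple f = ∀ j i → ¬ (PosArc f j i × NegArc f j i)

AndNet : ∀ {n} → Network n → Set
AndNet f = Simple f ×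
  (∀ i x → (lookup (f x) i ≡ true) ⇔
     ((∀ j → PosArc f j i → ¬ (lookup x j ≡ false)) × (∀ j → NegArc f j i → ¬ (lookup x j ≡ true))))

iterate : ∀ {A : Set} → (A → A) → ℕ → A → A
iterate s zero a = a
iterate s (suc k) a = s (iterate s k a)

-- underlying unsigned digraph of G(f) is a directed cycle through all of V:
-- there is a successor map s whose arcs are exactly the arcs of G(f), and
-- every vertex is reachable from every vertex along s (a loop when |V| = 1).
-- Additionally `sign` records which cycle arcs are negative; `P` is imposed on
-- the number of negative arcs.
CircularWith : ∀ {n} → (ℕ → Set) → Network n → Set
CircularWith {n} P f = Simple f × Σ (Fin n → Fin n) λ s →
  (∀ j i → Arc f j i ⇔ (i ≡ s j)) ×
  (∀ j i → ∃ λ k → iterate s k j ≡ i) ×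
  Σ (Fin n → Bool) λ sign →
    (∀ j → (sign j ≡ true) ⇔ NegArc f j (s j)) ×
    P (weight (tabulate sign))

PositiveCircular NegativeCircular : ∀ {n} → Network n → Set
PositiveCircular = CircularWith EvenNat
NegativeCircular = CircularWith (λ k → ¬ EvenNat k)

module Submission where

-- In a circular network every component reads a single variable: f_i(x) = x_{p i} ⊕ c_i, where p i is
-- the predecessor of i on the cycle and c_i = 1 exactly when the arc p i → i is negative.  Such a
-- network is self-dual and an and-net, and f̃(x)_i = (x_{p i} ⊕ x_i) ⊕ c_i, i.e. f̃(x) is the
-- coboundary of x along the cycle, shifted by c.  Coboundaries along a permutation are even, and along
-- a single cycle every even point is one (the coboundary of the indicator of a path is the pair of its
-- endpoints), so f̃ hits exactly the points whose parity is that of c, the number of negative arcs.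
-- Conversely, self-duality gives every vertex an in-arc and the and-net property makes it unique, so
-- the same formula holds; the parity constraint on the image of f̃ forces p to be a permutation, and
-- surjectivity onto a parity class forces its functional graph to be a single cycle.

open import Defs
open import Algebra.Bundles using (CommutativeRing; CommutativeMonoid)
open import Data.Bool using (Bool; true; false; not; _xor_; _∧_; if_then_else_)
open import Data.Bool.Properties
  using (xor-∧-commutativeRing; xor-assoc; xor-comm; xor-same; xor-identityʳ;
         not-distribˡ-xor; not-distribʳ-xor; not-involutive; ¬-not; not-¬)
  renaming (_≟_ to _≟ᵇ_)
open import Data.Fin using (Fin; zero; suc; toℕ; punchOut)
open import Data.Fin.Permutation using (Permutation′; _⟨$⟩ʳ_; _⟨$⟩ˡ_; inverseˡ; inverseʳ; permutation)
import Data.Fin.Permutation as Perm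
open import Data.Fin.Properties using (_≟_; any?; pigeonhole; punchOut-injective; injective⇒≤)
open import Data.Nat using (ℕ; zero; suc; _+_; _%_)
open import Data.Nat.DivMod using (%-distribˡ-+)
open import Data.Nat.Properties using (n<1+n; +-suc; m≤n⇒∃[o]m+o≡n; 1+n≰n)
open import Data.Product using (_×_; _,_; proj₁; proj₂; ∃; map₂)
open import Data.Sum using (_⊎_; inj₁; inj₂; [_,_]′)
open import Data.Vec using ([]; _∷_; lookup; _[_]≔_; replicate; tabulate)
open import Data.Vec.Properties
  using (lookup∘update; lookup∘update′; lookup-zipWith; lookup-replicate; lookup∘tabulate; tabulate-cong)
open import Data.Vec.Relation.Binary.Pointwise.Extensional using (ext; Pointwise-≡⇒≡)
open import Function using (_∘_; id)
open import Function.Bundles using (_⇔_; mk⇔; Equivalence)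
open import Function.Definitions using (Injective; StrictlySurjective; StrictlyInverseˡ; StrictlyInverseʳ)
import Function.Properties.Equivalence as ⇔
open import Level using (0ℓ)
open import Relation.Nullary using (¬_; yes; no; does; contradiction)
open import Relation.Binary.PropositionalEquality

open Equivalence using (to; from)

xor-commutativeMonoid : CommutativeMonoid 0ℓ 0ℓ
xor-commutativeMonoid = CommutativeRing.+-commutativeMonoid xor-∧-commutativeRing

open import Algebra.Properties.CommutativeMonoid.Sum xor-commutativeMonoid
  using (sum; sum-cong-≗; ∑-distrib-+; ∑-permute)
open import Algebra.Properties.CommutativeSemigroup (CommutativeMonoid.commutativeSemigroup xor-commutativeMonoid)
  using (interchange; xy∙z≈xz∙y)

private
  variable
    n : ℕ

xor-cancelʳ : ∀ u v → (u xor v) xor v ≡ u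
xor-cancelʳ u v = trans (xor-assoc u v v) (trans (cong (u xor_) (xor-same v)) (xor-identityʳ u))

xor-telescope : ∀ u v w → (u xor v) xor (v xor w) ≡ u xor w
xor-telescope u v w =
  trans (xor-assoc u v (v xor w)) (cong (u xor_) (trans (sym (xor-assoc v v w)) (cong (_xor w) (xor-same v))))

∧-xor-absorb : ∀ u v → (u ∧ v) xor v ≡ not u ∧ v
∧-xor-absorb false v = refl
∧-xor-absorb true  v = xor-same v

xor≡false⇒≡ : ∀ {u v} → u xor v ≡ false → u ≡ v
xor≡false⇒≡ {u} {v} e = trans (sym (xor-cancelʳ u v)) (cong (_xor v) e)

xor≡true⇒≢ : ∀ {u v} → u xor v ≡ true → u ≢ v
xor≡true⇒≢ {u} e refl = contradiction (trans (sym (xor-same u)) e) λ ()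

≡true⇔≡true⇒≡ : ∀ {u v} → (u ≡ true ⇔ v ≡ true) → u ≡ v
≡true⇔≡true⇒≡ {false} {false} _ = refl
≡true⇔≡true⇒≡ {false} {true}  h = from h refl
≡true⇔≡true⇒≡ {true}  {false} h = sym (to h refl)
≡true⇔≡true⇒≡ {true}  {true}  _ = refl

-- Parity of points

zeros : Point n
zeros = replicate _ false

δ : Fin n → Fin n → Bool
δ j i = does (j ≟ i)

toggle : Fin n → Point n → Point n
toggle j x = x [ j ]≔ not (lookup x j)

unit : Fin n → Point n
unit j = toggle j zeros

parity : Point n → Bool
parity x = sum (lookup x)

δ-refl : ∀ (j : Fin n) → δ j j ≡ true
δ-refl j with j ≟ j
... | yes _ = refl
... | no j≢j = contradiction refl j≢j

δ-≢ : ∀ {j i : Fin n} → j ≢ i → δ j i ≡ false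
δ-≢ {j = j} {i} j≢i with j ≟ i
... | yes j≡i = contradiction j≡i j≢i
... | no _ = refl

lookup-⊕ : ∀ (x y : Point n) i → lookup (x ⊕ y) i ≡ lookup x i xor lookup y i
lookup-⊕ x y i = lookup-zipWith _xor_ i x y

lookup-⊕-ones : ∀ (x : Point n) i → lookup (x ⊕ ones) i ≡ not (lookup x i)
lookup-⊕-ones x i =
  trans (lookup-⊕ x ones i) (trans (cong (lookup x i xor_) (lookup-replicate i true)) (xor-comm _ true))

lookup-zeros : ∀ (i : Fin n) → lookup zeros i ≡ false
lookup-zeros i = lookup-replicate i false

lookup-toggle : ∀ j (x : Point n) i → lookup (toggle j x) i ≡ lookup x i xor δ j i
lookup-toggle j x i with j ≟ i
... | yes refl = trans (lookup∘update j x _) (xor-comm true (lookup x j))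
... | no j≢i   = trans (lookup∘update′ (j≢i ∘ sym) x _) (sym (xor-identityʳ _))

lookup-unit : ∀ (j i : Fin n) → lookup (unit j) i ≡ δ j i
lookup-unit j i = trans (lookup-toggle j zeros i) (cong (_xor δ j i) (lookup-zeros i))

toggle-induction : (P : Point n → Set) → P zeros → (∀ j x → P x → P (toggle j x)) → ∀ x → P x
toggle-induction P base step [] = base
toggle-induction P base step (false ∷ x) =
  toggle-induction (P ∘ (false ∷_)) base (λ j → step (suc j) ∘ (false ∷_)) x
toggle-induction P base step (true ∷ x) =
  step zero (false ∷ x) (toggle-induction (P ∘ (false ∷_)) base (λ j → step (suc j) ∘ (false ∷_)) x)

parity-⊕ : ∀ (x y : Point n) → parity (x ⊕ y) ≡ parity x xor parity y
parity-⊕ x y = trans (sum-cong-≗ (lookup-⊕ x y)) (∑-distrib-+ (lookup x) (lookup y))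

parity-toggle : ∀ j (x : Point n) → parity (toggle j x) ≡ not (parity x)
parity-toggle zero    (a ∷ x) = sym (not-distribˡ-xor a (parity x))
parity-toggle (suc j) (a ∷ x) = trans (cong (a xor_) (parity-toggle j x)) (sym (not-distribʳ-xor a (parity x)))

parity-zeros : parity (zeros {n}) ≡ false
parity-zeros {zero}  = refl
parity-zeros {suc n} = parity-zeros {n}

parity-unit : ∀ (j : Fin n) → parity (unit j) ≡ true
parity-unit {n} j = trans (parity-toggle j zeros) (cong not (parity-zeros {n}))

weight%2≡parity : ∀ (x : Point n) → weight x % 2 ≡ (if parity x then 1 else 0)
weight%2≡parity [] = refl
weight%2≡parity (false ∷ x) = weight%2≡parity x
weight%2≡parity (true ∷ x) =
  trans (%-distribˡ-+ 1 (weight x) 2) (trans (cong (λ r → (1 + r) % 2) (weight%2≡parity x)) (step (parity x)))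
  where
  step : ∀ b → (1 + (if b then 1 else 0)) % 2 ≡ (if not b then 1 else 0)
  step false = refl
  step true  = refl

even⇔parity≡false : ∀ (x : Point n) → EvenPoint x ⇔ (parity x ≡ false)
even⇔parity≡false x with parity x | weight%2≡parity x
... | false | w = mk⇔ (λ _ → refl) (λ _ → w)
... | true  | w = mk⇔ (λ e → contradiction (trans (sym w) e) λ ()) λ ()

odd⇔parity≡true : ∀ (x : Point n) → OddPoint x ⇔ (parity x ≡ true)
odd⇔parity≡true x with parity x | weight%2≡parity x
... | false | w = mk⇔ (λ odd → contradiction w odd) λ ()
... | true  | w = mk⇔ (λ _ → refl) (λ _ e → contradiction (trans (sym w) e) λ ())

-- Permutations of Fin n and their orbits

injective⇒surjective : ∀ {g : Fin n → Fin n} → Injective _≡_ _≡_ g → StrictlySurjective _≡_ g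
injective⇒surjective {suc m} {g} g-injective y with any? (λ x → g x ≟ y)
... | yes hit = hit
... | no miss = contradiction (injective⇒≤ punched-injective) 1+n≰n
  where
  misses : ∀ x → y ≢ g x
  misses x y≡gx = miss (x , sym y≡gx)

  punched : Fin (suc m) → Fin m
  punched x = punchOut (misses x)

  punched-injective : Injective _≡_ _≡_ punched
  punched-injective {x} {x′} = g-injective ∘ punchOut-injective (misses x) (misses x′)

rightInverse⇒permutation : (s p : Fin n → Fin n) → StrictlyInverseˡ _≡_ s p → Permutation′ n
rightInverse⇒permutation s p s∘p≗id = permutation s p s∘p≗id p∘s≗id
  where
  p-injective : Injective _≡_ _≡_ p
  p-injective {i} {j} e = trans (sym (s∘p≗id i)) (trans (cong s e) (s∘p≗id j))

  p∘s≗id : StrictlyInverseʳ _≡_ s p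
  p∘s≗id j with injective⇒surjective p-injective j
  ... | i , refl = cong p (s∘p≗id i)

pred⇔succ : ∀ (π : Permutation′ n) {j i} → (j ≡ π ⟨$⟩ˡ i) ⇔ (i ≡ π ⟨$⟩ʳ j)
pred⇔succ π = mk⇔ (λ { refl → sym (inverseʳ π) }) (λ { refl → sym (inverseˡ π) })

δ-⟨$⟩ : ∀ (π : Permutation′ n) j i → δ j (π ⟨$⟩ˡ i) ≡ δ (π ⟨$⟩ʳ j) i
δ-⟨$⟩ π j i with π ⟨$⟩ʳ j ≟ i
... | yes refl = trans (cong (δ j) (inverseˡ π)) (δ-refl j)
... | no sj≢i  = δ-≢ λ j≡pi → sj≢i (trans (cong (π ⟨$⟩ʳ_) j≡pi) (inverseʳ π))

StronglyConnected : (Fin n → Fin n) → Set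
StronglyConnected {n} s = ∀ (a b : Fin n) → ∃ λ k → iterate s k a ≡ b

connected⇒surjective : ∀ {s : Fin n → Fin n} → StronglyConnected s → StrictlySurjective _≡_ s
connected⇒surjective {s = s} connected i with connected (s i) i
... | zero  , si≡i    = i , si≡i
... | suc k , reached = iterate s k (s i) , reached

iterate-+ : ∀ {A : Set} (s : A → A) k l a → iterate s (k + l) a ≡ iterate s k (iterate s l a)
iterate-+ s zero    l a = refl
iterate-+ s (suc k) l a = cong s (iterate-+ s k l a)

iterate-injective : ∀ (π : Permutation′ n) k {u v} → iterate (π ⟨$⟩ʳ_) k u ≡ iterate (π ⟨$⟩ʳ_) k v → u ≡ v
iterate-injective π zero    e = e
iterate-injective π (suc k) e =
  iterate-injective π k (trans (sym (inverseˡ π)) (trans (cong (π ⟨$⟩ˡ_) e) (inverseˡ π)))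

iterate-periodic : ∀ (π : Permutation′ n) a → ∃ λ k → iterate (π ⟨$⟩ʳ_) (suc k) a ≡ a
iterate-periodic {n} π a with pigeonhole (n<1+n n) (λ k → iterate (π ⟨$⟩ʳ_) (toℕ k) a)
... | i , j , i<j , same with m≤n⇒∃[o]m+o≡n i<j
...   | d , i+1+d≡j = d , sym (iterate-injective π (toℕ i) (begin
  iterate s (toℕ i) a                     ≡⟨ same ⟩
  iterate s (toℕ j) a                     ≡⟨ cong (λ k → iterate s k a) (trans (sym i+1+d≡j) (sym (+-suc (toℕ i) d))) ⟩
  iterate s (toℕ i + suc d) a             ≡⟨ iterate-+ s (toℕ i) (suc d) a ⟩
  iterate s (toℕ i) (iterate s (suc d) a) ∎))
  where
  open ≡-Reasoning
  s = π ⟨$⟩ʳ_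

-- Coboundaries along a functional graph

∂ : (Fin n → Fin n) → Point n → Fin n → Bool
∂ p x i = lookup x (p i) xor lookup x i

∂-⊕ : ∀ (p : Fin n → Fin n) x y i → ∂ p (x ⊕ y) i ≡ ∂ p x i xor ∂ p y i
∂-⊕ p x y i = trans (cong₂ _xor_ (lookup-⊕ x y (p i)) (lookup-⊕ x y i))
                    (interchange (lookup x (p i)) (lookup y (p i)) (lookup x i) (lookup y i))

module _ (π : Permutation′ n) where

  private
    s p : Fin n → Fin n
    s = π ⟨$⟩ʳ_
    p = π ⟨$⟩ˡ_

  sum-∂ : ∀ x → sum (∂ p x) ≡ false
  sum-∂ x = trans (∑-distrib-+ (lookup x ∘ p) (lookup x))
                  (trans (cong (_xor parity x) (sym (∑-permute (lookup x) (Perm.flip π)))) (xor-same (parity x)))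

  IsCoboundary : (Fin n → Bool) → Set
  IsCoboundary y = ∃ λ x → ∂ p x ≗ y

  isCoboundary-resp : ∀ {y y′} → y ≗ y′ → IsCoboundary y → IsCoboundary y′
  isCoboundary-resp y≗y′ (x , ∂x≗y) = x , λ i → trans (∂x≗y i) (y≗y′ i)

  isCoboundary-xor : ∀ {y y′} → IsCoboundary y → IsCoboundary y′ → IsCoboundary (λ i → y i xor y′ i)
  isCoboundary-xor (x , ∂x≗y) (x′ , ∂x′≗y′) =
    x ⊕ x′ , λ i → trans (∂-⊕ p x x′ i) (cong₂ _xor_ (∂x≗y i) (∂x′≗y′ i))

  isCoboundary-false : IsCoboundary (λ _ → false)
  isCoboundary-false = zeros , λ i → cong₂ _xor_ (lookup-zeros (p i)) (lookup-zeros i)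

  isCoboundary-arc : ∀ j → IsCoboundary (λ i → δ (s j) i xor δ j i)
  isCoboundary-arc j = unit j , λ i → cong₂ _xor_ (trans (lookup-unit j (p i)) (δ-⟨$⟩ π j i)) (lookup-unit j i)

  isCoboundary-path : ∀ a k → IsCoboundary (λ i → δ (iterate s k a) i xor δ a i)
  isCoboundary-path a zero    = isCoboundary-resp (λ i → sym (xor-same (δ a i))) isCoboundary-false
  isCoboundary-path a (suc k) = isCoboundary-resp
    (λ i → xor-telescope (δ (iterate s (suc k) a) i) (δ (iterate s k a) i) (δ a i))
    (isCoboundary-xor (isCoboundary-arc (iterate s k a)) (isCoboundary-path a k))

  isCoboundary-pair : StronglyConnected s → ∀ a b → IsCoboundary (λ i → δ b i xor δ a i)
  isCoboundary-pair connected a b with connected a b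
  ... | k , refl = isCoboundary-path a k

  -- Toggling y_j changes the target by δ_j ⊕ δ_r, the coboundary of a path from r to j.
  isCoboundary-rooted : StronglyConnected s → ∀ r y → IsCoboundary (λ i → lookup y i xor (parity y ∧ δ r i))
  isCoboundary-rooted connected r = toggle-induction _ base step
    where
    base : IsCoboundary (λ i → lookup zeros i xor (parity (zeros {n}) ∧ δ r i))
    base = isCoboundary-resp
      (λ i → sym (cong₂ (λ u v → u xor (v ∧ δ r i)) (lookup-zeros i) (parity-zeros {n}))) isCoboundary-false

    step : ∀ j y → IsCoboundary (λ i → lookup y i xor (parity y ∧ δ r i)) →
           IsCoboundary (λ i → lookup (toggle j y) i xor (parity (toggle j y) ∧ δ r i))
    step j y ih = isCoboundary-resp rearrange (isCoboundary-xor ih (isCoboundary-pair connected r j))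
      where
      open ≡-Reasoning
      rearrange : ∀ i → (lookup y i xor (parity y ∧ δ r i)) xor (δ j i xor δ r i)
                      ≡ lookup (toggle j y) i xor (parity (toggle j y) ∧ δ r i)
      rearrange i = begin
        (lookup y i xor (parity y ∧ δ r i)) xor (δ j i xor δ r i)
          ≡⟨ interchange (lookup y i) _ (δ j i) (δ r i) ⟩
        (lookup y i xor δ j i) xor ((parity y ∧ δ r i) xor δ r i)
          ≡⟨ cong₂ _xor_ (sym (lookup-toggle j y i)) (∧-xor-absorb (parity y) (δ r i)) ⟩
        lookup (toggle j y) i xor (not (parity y) ∧ δ r i)
          ≡⟨ cong (λ b → lookup (toggle j y) i xor (b ∧ δ r i)) (sym (parity-toggle j y)) ⟩
        lookup (toggle j y) i xor (parity (toggle j y) ∧ δ r i)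
          ∎

  even⇒isCoboundary : StronglyConnected s → ∀ y → parity y ≡ false → IsCoboundary (lookup y)
  even⇒isCoboundary connected [] _ = zeros , λ ()
  even⇒isCoboundary connected y@(_ ∷ _) even = isCoboundary-resp
    (λ i → trans (cong (λ b → lookup y i xor (b ∧ δ zero i)) even) (xor-identityʳ (lookup y i)))
    (isCoboundary-rooted connected zero y)

  -- x is constant along s except on entering a and b; the orbit of a returns to a, so it meets b.
  ∂-pair⇒reachable : ∀ {a b} x → a ≢ b → ∂ p x ≗ (λ i → δ b i xor δ a i) → ∃ λ k → iterate s k a ≡ b
  ∂-pair⇒reachable {a} {b} x a≢b ∂x≗pair = reach (iterate-periodic π a)
    where
    flat : ∀ i → i ≢ a → i ≢ b → lookup x (p i) ≡ lookup x i
    flat i i≢a i≢b = xor≡false⇒≡ (trans (∂x≗pair i) (cong₂ _xor_ (δ-≢ (i≢b ∘ sym)) (δ-≢ (i≢a ∘ sym))))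

    jumps-at-a : lookup x (p a) ≢ lookup x a
    jumps-at-a = xor≡true⇒≢ (trans (∂x≗pair a) (cong₂ _xor_ (δ-≢ (a≢b ∘ sym)) (δ-refl a)))

    walk : ∀ k → (∃ λ k′ → iterate s k′ a ≡ b) ⊎ lookup x (iterate s k a) ≡ lookup x a
    walk zero = inj₂ refl
    walk (suc k) with walk k | iterate s (suc k) a ≟ b | iterate s (suc k) a ≟ a
    ... | inj₁ reached | _       | _        = inj₁ reached
    ... | inj₂ _       | yes hit | _        = inj₁ (suc k , hit)
    ... | inj₂ _       | no _    | yes back = inj₂ (cong (lookup x) back)
    ... | inj₂ same    | no ≢b   | no ≢a    =
      inj₂ (trans (sym (flat _ ≢a ≢b)) (trans (cong (lookup x) (inverseˡ π)) same))

    reach : (∃ λ k → iterate s (suc k) a ≡ a) → ∃ λ k → iterate s k a ≡ b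
    reach (k , returns) = [ id , (λ same → contradiction (trans pred-a same) jumps-at-a) ]′ (walk k)
      where
      pred-a : lookup x (p a) ≡ lookup x (iterate s k a)
      pred-a = cong (lookup x) (trans (cong p (sym returns)) (inverseˡ π))

-- Networks whose components each read a single variable

component : Network n → Fin n → Point n → Bool
component f i x = lookup (f x) i

Sensitive : (Point n → Bool) → Fin n → Point n → Set
Sensitive g j z = g (z [ j ]≔ false) ≢ g (z [ j ]≔ true)

sensitive⇒arc : ∀ (f : Network n) {j i z} → Sensitive (component f i) j z → Arc f j i
sensitive⇒arc f {j} {i} {z} sens
  with component f i (z [ j ]≔ false) in at-false | component f i (z [ j ]≔ true) in at-true
... | false | false = contradiction refl sens
... | false | true  = inj₁ (z , at-false , at-true)
... | true  | false = inj₂ (z , at-false , at-true)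
... | true  | true  = contradiction refl sens

arc⇒sensitive : ∀ (f : Network n) {j i} → Arc f j i → ∃ (Sensitive (component f i) j)
arc⇒sensitive f (inj₁ (z , at-false , at-true)) = z , λ e → contradiction (trans (sym at-false) (trans e at-true)) λ ()
arc⇒sensitive f (inj₂ (z , at-false , at-true)) = z , λ e → contradiction (trans (sym at-false) (trans e at-true)) λ ()

differ⇒sensitive : ∀ (g : Point n → Bool) {x y} → g x ≢ g y →
                   ∃ λ j → lookup x j ≢ lookup y j × ∃ (Sensitive g j)
differ⇒sensitive g {[]} {[]} g-differs = contradiction refl g-differs
differ⇒sensitive g {a ∷ x} {b ∷ y} g-differs with g (a ∷ x) ≟ᵇ g (b ∷ x)
... | no head-differs = zero , head-differs ∘ cong (λ c → g (c ∷ x)) , a ∷ x , false≢true a b head-differs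
  where
  false≢true : ∀ a b → g (a ∷ x) ≢ g (b ∷ x) → g (false ∷ x) ≢ g (true ∷ x)
  false≢true false false ne = contradiction refl ne
  false≢true false true  ne = ne
  false≢true true  false ne = ne ∘ sym
  false≢true true  true  ne = contradiction refl ne
... | yes head-same with differ⇒sensitive (g ∘ (b ∷_)) (g-differs ∘ trans head-same)
...   | j , differs , z , sens = suc j , differs , b ∷ z , sens

module SingleInput (f : Network n) (p : Fin n → Fin n) (arc⇔pred : ∀ j i → Arc f j i ⇔ (j ≡ p i)) where

  c : Point n
  c = f zeros

  depends-only-on-pred : ∀ i {x y} → lookup x (p i) ≡ lookup y (p i) → component f i x ≡ component f i y
  depends-only-on-pred i {x} {y} agree with component f i x ≟ᵇ component f i y
  ... | yes same = same
  ... | no differs with differ⇒sensitive (component f i) differs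
  ...   | j , disagree , _ , sens with to (arc⇔pred j i) (sensitive⇒arc f sens)
  ...     | refl = contradiction agree disagree

  restrict-to-pred : ∀ i x → component f i x ≡ component f i (zeros [ p i ]≔ lookup x (p i))
  restrict-to-pred i x = depends-only-on-pred i (sym (lookup∘update (p i) zeros _))

  sensitive-to-pred : ∀ i → Sensitive (component f i) (p i) zeros
  sensitive-to-pred i with arc⇒sensitive f (from (arc⇔pred (p i) i) refl)
  ... | z , sens = λ e → sens (trans (moved false) (trans e (sym (moved true))))
    where
    moved : ∀ b → component f i (z [ p i ]≔ b) ≡ component f i (zeros [ p i ]≔ b)
    moved b = trans (restrict-to-pred i _) (cong (λ v → component f i (zeros [ p i ]≔ v)) (lookup∘update (p i) z b))

  component-formula : ∀ i x → component f i x ≡ lookup x (p i) xor lookup c i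
  component-formula i x = trans (restrict-to-pred i x) (by-value (lookup x (p i)))
    where
    by-value : ∀ b → component f i (zeros [ p i ]≔ b) ≡ b xor lookup c i
    by-value false = sym (trans (restrict-to-pred i zeros)
                                (cong (λ v → component f i (zeros [ p i ]≔ v)) (lookup-zeros (p i))))
    by-value true  = ¬-not λ e → sensitive-to-pred i (trans (by-value false) (sym e))

  component-at-pred : ∀ i z b → component f i (z [ p i ]≔ b) ≡ b xor lookup c i
  component-at-pred i z b = trans (component-formula i _) (cong (_xor lookup c i) (lookup∘update (p i) z b))

  posArc⇔ : ∀ j i → PosArc f j i ⇔ (j ≡ p i × lookup c i ≡ false)
  posArc⇔ j i = mk⇔ into λ { (refl , c≡false) → zeros , trans (component-at-pred i zeros false) c≡false
                                                     , trans (component-at-pred i zeros true) (cong not c≡false) }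
    where
    into : PosArc f j i → j ≡ p i × lookup c i ≡ false
    into arc@(z , at-false , _) with to (arc⇔pred j i) (inj₁ arc)
    ... | refl = refl , trans (sym (component-at-pred i z false)) at-false

  negArc⇔ : ∀ j i → NegArc f j i ⇔ (j ≡ p i × lookup c i ≡ true)
  negArc⇔ j i = mk⇔ into λ { (refl , c≡true) → zeros , trans (component-at-pred i zeros false) c≡true
                                                    , trans (component-at-pred i zeros true) (cong not c≡true) }
    where
    into : NegArc f j i → j ≡ p i × lookup c i ≡ true
    into arc@(z , at-false , _) with to (arc⇔pred j i) (inj₂ arc)
    ... | refl = refl , trans (sym (component-at-pred i z false)) at-false

  selfDual : SelfDual f
  selfDual x = Pointwise-≡⇒≡ (ext λ i → begin
    lookup (f (x ⊕ ones)) i                 ≡⟨ component-formula i (x ⊕ ones) ⟩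
    lookup (x ⊕ ones) (p i) xor lookup c i  ≡⟨ cong (_xor lookup c i) (lookup-⊕-ones x (p i)) ⟩
    not (lookup x (p i)) xor lookup c i     ≡⟨ not-distribˡ-xor (lookup x (p i)) (lookup c i) ⟨
    not (lookup x (p i) xor lookup c i)     ≡⟨ cong not (component-formula i x) ⟨
    not (lookup (f x) i)                    ≡⟨ lookup-⊕-ones (f x) i ⟨
    lookup (f x ⊕ ones) i                   ∎)
    where open ≡-Reasoning

  andNet : Simple f → AndNet f
  andNet simple = simple , λ i x → mk⇔ (only-if i x) (if i x)
    where
    blocked : ∀ {j i x b} → j ≡ p i × lookup c i ≡ b → lookup x j ≡ b → component f i x ≡ false
    blocked {x = x} {b} (refl , c≡b) x≡b = trans (component-formula _ x) (trans (cong₂ _xor_ x≡b c≡b) (xor-same b))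

    only-if : ∀ i x → component f i x ≡ true →
              (∀ j → PosArc f j i → lookup x j ≢ false) × (∀ j → NegArc f j i → lookup x j ≢ true)
    only-if i x on =
      (λ j arc x≡false → contradiction (trans (sym on) (blocked (to (posArc⇔ j i) arc) x≡false)) λ ()) ,
      (λ j arc x≡true  → contradiction (trans (sym on) (blocked (to (negArc⇔ j i) arc) x≡true)) λ ())

    if : ∀ i x → (∀ j → PosArc f j i → lookup x j ≢ false) × (∀ j → NegArc f j i → lookup x j ≢ true) →
         component f i x ≡ true
    if i x (pos , neg) with lookup c i in c≡
    ... | false = trans (component-formula i x)
                        (cong₂ _xor_ (¬-not (pos (p i) (from (posArc⇔ (p i) i) (refl , c≡)))) c≡)
    ... | true  = trans (component-formula i x)
                        (cong₂ _xor_ (¬-not (neg (p i) (from (negArc⇔ (p i) i) (refl , c≡)))) c≡)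

  lookup-conj : ∀ x i → lookup (conj f x) i ≡ ∂ p x i xor lookup c i
  lookup-conj x i = trans (lookup-⊕ (f x) x i)
    (trans (cong (_xor lookup x i) (component-formula i x)) (xy∙z≈xz∙y (lookup x (p i)) (lookup c i) (lookup x i)))

  parity-conj : ∀ x → parity (conj f x) ≡ sum (∂ p x) xor parity c
  parity-conj x = trans (sum-cong-≗ (lookup-conj x)) (∑-distrib-+ (∂ p x) (lookup c))

  conj≡⇔∂≗ : ∀ x t → conj f x ≡ t ⇔ ∂ p x ≗ lookup (t ⊕ c)
  conj≡⇔∂≗ x t = mk⇔
    (λ { refl i → sym (trans (lookup-⊕ (conj f x) c i)
                             (trans (cong (_xor lookup c i) (lookup-conj x i)) (xor-cancelʳ _ _))) })
    (λ ∂x≗ → Pointwise-≡⇒≡ (ext λ i → trans (lookup-conj x i)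
                (trans (cong (_xor lookup c i) (trans (∂x≗ i) (lookup-⊕ t c i))) (xor-cancelʳ _ _))))

  -- Outside the image of p, toggling x_j changes f̃(x) in coordinate j only, which flips its parity.
  pred-surjective : (∀ x → parity (conj f x) ≡ parity c) → StrictlySurjective _≡_ p
  pred-surjective conj-parity j with any? (λ i → p i ≟ j)
  ... | yes hit = hit
  ... | no miss = contradiction
    (trans (sym (conj-parity (unit j))) (trans (parity-conj (unit j)) (cong (_xor parity c) sum-∂-unit)))
    (not-¬ refl)
    where
    sum-∂-unit : sum (∂ p (unit j)) ≡ true
    sum-∂-unit = trans (sum-cong-≗ λ i → cong (_xor lookup (unit j) i)
                                              (trans (lookup-unit j (p i)) (δ-≢ (miss ∘ (i ,_) ∘ sym))))
                       (parity-unit j)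

module PermutationNetwork (f : Network n) (π : Permutation′ n) (arc⇔pred : ∀ j i → Arc f j i ⇔ (j ≡ π ⟨$⟩ˡ i)) where

  open SingleInput f (π ⟨$⟩ˡ_) arc⇔pred public

  private
    s : Fin n → Fin n
    s = π ⟨$⟩ʳ_

  arc⇔succ : ∀ j i → Arc f j i ⇔ (i ≡ s j)
  arc⇔succ j i = ⇔.trans (arc⇔pred j i) (pred⇔succ π)

  parity-conj-constant : ∀ x → parity (conj f x) ≡ parity c
  parity-conj-constant x = trans (parity-conj x) (cong (_xor parity c) (sum-∂ π x))

  conj-onto : StronglyConnected s → ∀ t → parity t ≡ parity c → ∃ λ x → conj f x ≡ t
  conj-onto connected t t≡c = map₂ (from (conj≡⇔∂≗ _ t)) (even⇒isCoboundary π connected (t ⊕ c) t⊕c-even)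
    where
    t⊕c-even : parity (t ⊕ c) ≡ false
    t⊕c-even = trans (parity-⊕ t c) (trans (cong (_xor parity c) t≡c) (xor-same (parity c)))

  conj-onto⇒connected : (∀ t → parity t ≡ parity c → ∃ λ x → conj f x ≡ t) → StronglyConnected s
  conj-onto⇒connected onto a b with a ≟ b
  ... | yes a≡b = 0 , a≡b
  ... | no a≢b = reach (onto (pair ⊕ c) (trans (parity-⊕ pair c) (cong (_xor parity c) pair-even)))
    where
    pair : Point n
    pair = unit b ⊕ unit a

    pair-even : parity pair ≡ false
    pair-even = trans (parity-⊕ (unit b) (unit a)) (cong₂ _xor_ (parity-unit b) (parity-unit a))

    lookup-pair : ∀ i → lookup ((pair ⊕ c) ⊕ c) i ≡ δ b i xor δ a i
    lookup-pair i = begin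
      lookup ((pair ⊕ c) ⊕ c) i                     ≡⟨ lookup-⊕ (pair ⊕ c) c i ⟩
      lookup (pair ⊕ c) i xor lookup c i            ≡⟨ cong (_xor lookup c i) (lookup-⊕ pair c i) ⟩
      (lookup pair i xor lookup c i) xor lookup c i ≡⟨ xor-cancelʳ (lookup pair i) (lookup c i) ⟩
      lookup pair i                                 ≡⟨ lookup-⊕ (unit b) (unit a) i ⟩
      lookup (unit b) i xor lookup (unit a) i       ≡⟨ cong₂ _xor_ (lookup-unit b i) (lookup-unit a i) ⟩
      δ b i xor δ a i                               ∎
      where open ≡-Reasoning

    reach : (∃ λ x → conj f x ≡ pair ⊕ c) → ∃ λ k → iterate s k a ≡ b
    reach (x , conj≡) = ∂-pair⇒reachable π x a≢b λ i → trans (to (conj≡⇔∂≗ x (pair ⊕ c)) conj≡ i) (lookup-pair i)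

  signs : Fin n → Bool
  signs j = lookup c (s j)

  signs⇔negArc : ∀ j → (signs j ≡ true) ⇔ NegArc f j (s j)
  signs⇔negArc j = mk⇔ (λ c≡true → from (negArc⇔ j (s j)) (sym (inverseˡ π) , c≡true))
                       (λ arc → proj₂ (to (negArc⇔ j (s j)) arc))

  parity-signs : parity (tabulate signs) ≡ parity c
  parity-signs = trans (sum-cong-≗ (lookup∘tabulate signs)) (sym (∑-permute (lookup c) π))

-- In-arcs of self-dual and-nets

selfDual⇒inArc : ∀ {f : Network n} → SelfDual f → ∀ i → ∃ λ j → Arc f j i
selfDual⇒inArc {f = f} self-dual i = arc-from (differ⇒sensitive (component f i) flips)
  where
  flips : component f i zeros ≢ component f i (zeros ⊕ ones)
  flips e = not-¬ refl (trans e (trans (cong (λ v → lookup v i) (self-dual zeros)) (lookup-⊕-ones (f zeros) i)))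

  arc-from : (∃ λ j → lookup zeros j ≢ lookup (zeros ⊕ ones) j × ∃ (Sensitive (component f i) j)) →
             ∃ λ j → Arc f j i
  arc-from (j , _ , _ , sens) = j , sensitive⇒arc f sens

blocker : ∀ {f : Network n} {j i} → Arc f j i → Bool
blocker (inj₁ _) = false
blocker (inj₂ _) = true

andNet-blocked : ∀ {f : Network n} → AndNet f → ∀ {j i x} (arc : Arc f j i) →
                 lookup x j ≡ blocker {f = f} arc → component f i x ≡ false
andNet-blocked (_ , and) {j} {i} {x} (inj₁ arc) x≡false = ¬-not λ on → proj₁ (to (and i x) on) j arc x≡false
andNet-blocked (_ , and) {j} {i} {x} (inj₂ arc) x≡true  = ¬-not λ on → proj₂ (to (and i x) on) j arc x≡true

-- Block i through j at x and through k at the complement of x: self-duality forbids both values being false.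
inArc-unique : ∀ {f : Network n} → SelfDual f → AndNet f → ∀ {j k i} → Arc f j i → Arc f k i → j ≡ k
inArc-unique {f = f} self-dual and {j} {k} {i} arc-j arc-k with j ≟ k
... | yes j≡k = j≡k
... | no j≢k =
  contradiction (trans (sym (andNet-blocked {f = f} and arc-k complement-blocked)) complement-value) λ ()
  where
  y x : Point _
  y = zeros [ k ]≔ not (blocker {f = f} arc-k)
  x = y [ j ]≔ blocker {f = f} arc-j

  complement-blocked : lookup (x ⊕ ones) k ≡ blocker {f = f} arc-k
  complement-blocked = trans (lookup-⊕-ones x k)
    (trans (cong not (trans (lookup∘update′ (j≢k ∘ sym) y _) (lookup∘update k zeros _))) (not-involutive _))

  complement-value : component f i (x ⊕ ones) ≡ true
  complement-value = trans (cong (λ v → lookup v i) (self-dual x))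
    (trans (lookup-⊕-ones (f x) i) (cong not (andNet-blocked {f = f} and arc-j (lookup∘update j y _))))

ConjImage : Network n → (Point n → Set) → Set
ConjImage f P = ∀ y → (∃ λ x → conj f x ≡ y) ⇔ P y

module _ {P : ℕ → Set} {β : Bool} (P⇔parity : ∀ {n} (x : Point n) → P (weight x) ⇔ (parity x ≡ β))
         {f : Network n} where

  circular⇒selfDual-andNet : CircularWith P f → (ConjImage f (P ∘ weight) × SelfDual f) × AndNet f
  circular⇒selfDual-andNet (simple , s , arc⇔succ , connected , sign , sign⇔negArc , P-sign) =
    (image , selfDual) , andNet simple
    where
    π : Permutation′ _
    π = rightInverse⇒permutation s (proj₁ ∘ connected⇒surjective connected) (proj₂ ∘ connected⇒surjective connected)

    open PermutationNetwork f π (λ j i → ⇔.trans (arc⇔succ j i) (⇔.sym (pred⇔succ π)))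

    sign≗signs : ∀ j → sign j ≡ signs j
    sign≗signs j = ≡true⇔≡true⇒≡ (⇔.trans (sign⇔negArc j) (⇔.sym (signs⇔negArc j)))

    parity-c : parity c ≡ β
    parity-c = trans (sym parity-signs)
                     (trans (cong parity (tabulate-cong (sym ∘ sign≗signs))) (to (P⇔parity (tabulate sign)) P-sign))

    image : ConjImage f (P ∘ weight)
    image y = mk⇔ (λ { (x , refl) → from (P⇔parity (conj f x)) (trans (parity-conj-constant x) parity-c) })
                  (λ Py → conj-onto connected y (trans (to (P⇔parity y) Py) (sym parity-c)))

  selfDual-andNet⇒circular : (ConjImage f (P ∘ weight) × SelfDual f) × AndNet f → CircularWith P f
  selfDual-andNet⇒circular ((image , self-dual) , and-net) =
    proj₁ and-net , _ , arc⇔succ , conj-onto⇒connected onto ,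
    signs , signs⇔negArc , from (P⇔parity (tabulate signs)) (trans parity-signs parity-c)
    where
    p : Fin _ → Fin _
    p i = proj₁ (selfDual⇒inArc self-dual i)

    arc⇔pred : ∀ j i → Arc f j i ⇔ (j ≡ p i)
    arc⇔pred j i = mk⇔ (λ arc → inArc-unique self-dual and-net arc (proj₂ (selfDual⇒inArc self-dual i)))
                       (λ { refl → proj₂ (selfDual⇒inArc self-dual i) })

    module S = SingleInput f p arc⇔pred

    parity-c : parity S.c ≡ β
    parity-c = trans (sym (trans (parity-⊕ S.c zeros) (trans (cong (parity S.c xor_) (parity-zeros {n})) (xor-identityʳ _))))
                     (to (P⇔parity (conj f zeros)) (to (image _) (zeros , refl)))

    p-surjective : StrictlySurjective _≡_ p
    p-surjective = S.pred-surjective λ x → trans (to (P⇔parity (conj f x)) (to (image _) (x , refl))) (sym parity-c)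

    π : Permutation′ _
    π = Perm.flip (rightInverse⇒permutation p (proj₁ ∘ p-surjective) (proj₂ ∘ p-surjective))

    open PermutationNetwork f π arc⇔pred

    onto : ∀ t → parity t ≡ parity c → ∃ λ x → conj f x ≡ t
    onto t t≡c = from (image t) (from (P⇔parity t) (trans t≡c parity-c))

  circular⇔selfDual-andNet : CircularWith P f ⇔ ((ConjImage f (P ∘ weight) × SelfDual f) × AndNet f)
  circular⇔selfDual-andNet = mk⇔ circular⇒selfDual-andNet selfDual-andNet⇒circular

proposition6 : (m : ℕ) (f : Network (suc m)) →
    (PositiveCircular f ⇔ (EvenSelfDual f × AndNet f)) ×
    (NegativeCircular f ⇔ (OddSelfDual f × AndNet f))
proposition6 m f = circular⇔selfDual-andNet {P = EvenNat} even⇔parity≡false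
                 , circular⇔selfDual-andNet {P = ¬_ ∘ EvenNat} odd⇔parity≡true
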